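{- Let $k\geq 1$ and $c_1,\ldots,c_k\in\mathbb{Z}$, and suppose \[P(x)=((\cdots((x^{2}-c_{1})^{2}-c_{2})^{2}\cdots)^{2}-c_{k-1})^{2}-c_{k}\in\mathbb{Z}[x]\] crumbles over $\mathbb{Z}$. Then $c_2\equiv c_3\equiv\cdots\equiv c_k\equiv 0\pmod 2$.
   Context: A polynomial $P\in\mathbb{Z}[x]$ crumbles over $\mathbb{Z}$ if $P$ can be written as a product of (not necessarily distinct) linear polynomials in $\mathbb{Z}[x]$. -}

module Defs where

open import Data.Nat using (ℕ; zero; suc)
open import Data.Integer using (ℤ; 0ℤ; 1ℤ; _+_; _*_; -_)
open import Data.List using (List; []; _∷_; foldr; map)
open import Data.Product using (_×_; proj₁; proj₂)
open import Relation.Binary.PropositionalEquality using (_≡_)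
open import Relation.Nullary using (¬_)

-- Polynomials in ℤ[x] as coefficient lists, lowest degree first:
-- a₀ ∷ a₁ ∷ … represents a₀ + a₁ x + …  (trailing zeros allowed).
Poly : Set
Poly = List ℤ

coeff : Poly → ℕ → ℤ
coeff []       _       = 0ℤ
coeff (a ∷ p)  zero    = a
coeff (a ∷ p)  (suc n) = coeff p n

_≈ₚ_ : Poly → Poly → Set
p ≈ₚ q = ∀ n → coeff p n ≡ coeff q n

infix 4 _≈ₚ_
infixl 6 _+ₚ_
infixl 7 _*ₚ_ _·_

_+ₚ_ : Poly → Poly → Poly
[]      +ₚ q       = q
p       +ₚ []      = p
(a ∷ p) +ₚ (b ∷ q) = (a + b) ∷ (p +ₚ q)

_·_ : ℤ → Poly → Poly
c · p = map (c *_) p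

_*ₚ_ : Poly → Poly → Poly
[]      *ₚ q = []
(a ∷ p) *ₚ q = (a · q) +ₚ (0ℤ ∷ (p *ₚ q))

constP : ℤ → Poly
constP c = c ∷ []

X : Poly
X = 0ℤ ∷ 1ℤ ∷ []

oneP : Poly
oneP = 1ℤ ∷ []

prodP : List Poly → Poly
prodP = foldr _*ₚ_ oneP

linP : ℤ × ℤ → Poly
linP ab = proj₂ ab ∷ proj₁ ab ∷ []

-- P crumbles over ℤ: P is a product of linear polynomials a x + b in ℤ[x]
-- (a ≠ 0, so each factor has degree exactly 1).
Crumbles : Poly → Set
Crumbles P = Data.Product.Σ (List (ℤ × ℤ)) λ fs →
  Data.List.Relation.Unary.All.All (λ ab → ¬ (proj₁ ab ≡ 0ℤ)) fs ×
  (P ≈ₚ prodP (map linP fs))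
  where import Data.List.Relation.Unary.All

-- iterated polynomial: iterP 0 c = x, iterP (k+1) c = (iterP k c)² - c k,
-- so iterP k c = ((x²-c 0)²-c 1)…)²-c (k-1)
-- (0-based indices: c i corresponds to the paper's c_{i+1}; values c i for i ≥ k unused).
iterP : (k : ℕ) → (ℕ → ℤ) → Poly
iterP zero    c = X
iterP (suc k) c = (iterP k c *ₚ iterP k c) +ₚ constP (- c k)

-- Write f_j for the j-th iterate  f₀(n) = n,  f_{j+1}(n) = f_j(n)² − c_{j+1},
-- so that P(n) = f_k(n).  Comparing degrees and leading coefficients, a
-- factorisation P = ∏ (aᵢ x + bᵢ) has 2^k factors with ∏ aᵢ = 1, so every aᵢ is
-- a unit and rᵢ = −aᵢbᵢ is an integer root with (aᵢ n + bᵢ) ∣ n − rᵢ.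
--
-- Key step (partner roots): for a root r of P and j < k, some root r' has
-- f_j(r') = −f_j(r).  Indeed g(n) = f_j(n) + f_j(r) divides f_k(n) − f_k(r) = P(n),
-- and P(n) = ∏ (aᵢ n + bᵢ) divides ∏ (g(n) − g(rᵢ)) ≡ ∏ (−g(rᵢ)) (mod g(n)); so every
-- value of the unbounded function g divides the constant ∏ (−g(rᵢ)), which must
-- therefore vanish.  Then 2 f_j(r) = f_{j−1}(r)² − f_{j−1}(r')², and since a
-- difference of two squares is odd or divisible by 4, f_j(r) is even for
-- 1 ≤ j ≤ k.  Finally c_{i+1} = f_i(r)² − f_{i+1}(r) is even for 1 ≤ i < k.
module Submission where

open import Defs
open import Data.Nat using (ℕ; zero; suc; z≤n; s≤s; _^_; _≤_; _<_; _≤′_; ≤′-refl; ≤′-step)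
import Data.Nat as ℕ
import Data.Nat.Properties as ℕP
import Data.Nat.Divisibility as ℕD
open import Data.Nat.Primality using (Prime; prime?; euclidsLemma)
open import Relation.Nullary.Decidable using (from-yes)
open import Data.Integer using (ℤ; +_; -[1+_]; 0ℤ; 1ℤ; _+_; _*_; -_; _-_; ∣_∣)
import Data.Integer.Properties as ℤP
open import Data.Integer.Divisibility using (_∣_)
open import Data.Integer.Divisibility.Signed as Signed
  using ( divides; ∣-refl; ∣-trans; ∣m∣n⇒∣m+n; ∣m+n∣n⇒∣m; ∣m∣n⇒∣m-n; ∣m⇒∣m*n; ∣n⇒∣m*n
        ; *-monoˡ-∣; *-monoʳ-∣; *-cancelˡ-∣; ∣⇒∣ᵤ; ∣ᵤ⇒∣)
open import Data.Integer.Tactic.RingSolver using (solve-∀)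
open import Data.List using (List; []; _∷_; map; length)
open import Data.List.Relation.Unary.All as All using (All; []; _∷_)
open import Data.List.Relation.Unary.All.Properties using (All¬⇒¬Any)
open import Data.List.Relation.Unary.Any as Any using (Any; here; there)
open import Data.Product using (_×_; _,_; proj₁; proj₂; ∃)
import Data.Product as Product
open import Data.Sum using (_⊎_; inj₁; inj₂)
import Data.Sum as Sum
open import Data.Empty using (⊥-elim)
open import Relation.Nullary using (¬_)
open import Relation.Binary.PropositionalEquality
open ≡-Reasoning
open import Relation.Binary.Definitions using (tri<; tri≈; tri>)

∏ : {A : Set} → (A → ℤ) → List A → ℤ
∏ f []       = 1ℤ
∏ f (x ∷ xs) = f x * ∏ f xs

∏-zero : {A : Set} (f : A → ℤ) (xs : List A) → ∏ f xs ≡ 0ℤ → Any (λ x → f x ≡ 0ℤ) xs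
∏-zero f []       ()
∏-zero f (x ∷ xs) e with ℤP.i*j≡0⇒i≡0∨j≡0 (f x) e
... | inj₁ fx≡0  = here fx≡0
... | inj₂ rest≡0 = there (∏-zero f xs rest≡0)

∏-mono-∣ : {A : Set} (f g : A → ℤ) (xs : List A) →
  All (λ x → f x Signed.∣ g x) xs → ∏ f xs Signed.∣ ∏ g xs
∏-mono-∣ f g []       []       = ∣-refl
∏-mono-∣ f g (x ∷ xs) (d ∷ ds) =
  ∣-trans (*-monoˡ-∣ (∏ f xs) d) (*-monoʳ-∣ (g x) (∏-mono-∣ f g xs ds))

∏-cong-mod : {A : Set} (m : ℤ) (f g : A → ℤ) (xs : List A) →
  (∀ x → m Signed.∣ f x - g x) → m Signed.∣ ∏ f xs - ∏ g xs
∏-cong-mod m f g []       _  = divides 0ℤ refl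
∏-cong-mod m f g (x ∷ xs) fg =
  subst (m Signed.∣_) (sym (split (f x) (g x) (∏ f xs) (∏ g xs)))
    (∣m∣n⇒∣m+n (∣m⇒∣m*n (∏ f xs) (fg x)) (∣n⇒∣m*n (g x) (∏-cong-mod m f g xs fg)))
  where
  split : ∀ a b u v → a * u - b * v ≡ (a - b) * u + b * (u - v)
  split = solve-∀

eval : Poly → ℤ → ℤ
eval []      n = 0ℤ
eval (a ∷ p) n = a + n * eval p n

eval-+ₚ : ∀ p q n → eval (p +ₚ q) n ≡ eval p n + eval q n
eval-+ₚ []      q       n = sym (ℤP.+-identityˡ _)
eval-+ₚ (a ∷ p) []      n = sym (ℤP.+-identityʳ _)
eval-+ₚ (a ∷ p) (b ∷ q) n rewrite eval-+ₚ p q n = shuffle a b n (eval p n) (eval q n)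
  where
  shuffle : ∀ a b n x y → a + b + n * (x + y) ≡ a + n * x + (b + n * y)
  shuffle = solve-∀

eval-· : ∀ c p n → eval (c · p) n ≡ c * eval p n
eval-· c []      n = sym (ℤP.*-zeroʳ c)
eval-· c (a ∷ p) n rewrite eval-· c p n = distrib c a n (eval p n)
  where
  distrib : ∀ c a n x → c * a + n * (c * x) ≡ c * (a + n * x)
  distrib = solve-∀

eval-*ₚ : ∀ p q n → eval (p *ₚ q) n ≡ eval p n * eval q n
eval-*ₚ []      q n = refl
eval-*ₚ (a ∷ p) q n
  rewrite eval-+ₚ (a · q) (0ℤ ∷ (p *ₚ q)) n | eval-· a q n | eval-*ₚ p q n
  = distrib a n (eval p n) (eval q n)
  where
  distrib : ∀ a n x y → a * y + (0ℤ + n * (x * y)) ≡ (a + n * x) * y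
  distrib = solve-∀

eval-zero : ∀ q n → [] ≈ₚ q → 0ℤ ≡ eval q n
eval-zero []      n e = refl
eval-zero (b ∷ q) n e =
  trans (zero-as-cons n) (cong₂ (λ a v → a + n * v) (e 0) (eval-zero q n (λ m → e (suc m))))
  where
  zero-as-cons : ∀ n → 0ℤ ≡ 0ℤ + n * 0ℤ
  zero-as-cons = solve-∀

eval-≈ₚ : ∀ p q n → p ≈ₚ q → eval p n ≡ eval q n
eval-≈ₚ []      q       n e = eval-zero q n e
eval-≈ₚ (a ∷ p) []      n e = sym (eval-zero (a ∷ p) n (λ m → sym (e m)))
eval-≈ₚ (a ∷ p) (b ∷ q) n e =
  cong₂ (λ a v → a + n * v) (e 0) (eval-≈ₚ p q n (λ m → e (suc m)))

iterate : ℕ → (ℕ → ℤ) → ℤ → ℤ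
iterate zero    c n = n
iterate (suc k) c n = iterate k c n * iterate k c n + - c k

eval-iterP : ∀ k c n → eval (iterP k c) n ≡ iterate k c n
eval-iterP zero    c n = eval-X n
  where
  eval-X : ∀ n → 0ℤ + n * (1ℤ + n * 0ℤ) ≡ n
  eval-X = solve-∀
eval-iterP (suc k) c n
  rewrite eval-+ₚ (iterP k c *ₚ iterP k c) (constP (- c k)) n
        | eval-*ₚ (iterP k c) (iterP k c) n | eval-iterP k c n
  = cong (_+_ (iterate k c n * iterate k c n)) (eval-const (- c k) n)
  where
  eval-const : ∀ a n → a + n * 0ℤ ≡ a
  eval-const = solve-∀

lin : ℤ × ℤ → ℤ → ℤ
lin (a , b) n = a * n + b

eval-prodP : ∀ fs n → eval (prodP (map linP fs)) n ≡ ∏ (λ ab → lin ab n) fs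
eval-prodP []             n = eval-one n
  where
  eval-one : ∀ n → 1ℤ + n * 0ℤ ≡ 1ℤ
  eval-one = solve-∀
eval-prodP ((a , b) ∷ fs) n
  rewrite eval-*ₚ (linP (a , b)) (prodP (map linP fs)) n | eval-prodP fs n
  = cong (_* ∏ (λ ab → lin ab n) fs) (eval-lin a b n)
  where
  eval-lin : ∀ a b n → b + n * (a + n * 0ℤ) ≡ a * n + b
  eval-lin = solve-∀

VanishesFrom : Poly → ℕ → Set
VanishesFrom p d = ∀ m → d ≤ m → coeff p m ≡ 0ℤ

Lead : Poly → ℕ → ℤ → Set
Lead p d t = (coeff p d ≡ t) × VanishesFrom p (suc d)

coeff-+ₚ : ∀ p q m → coeff (p +ₚ q) m ≡ coeff p m + coeff q m
coeff-+ₚ []      q       m       = sym (ℤP.+-identityˡ _)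
coeff-+ₚ (a ∷ p) []      zero    = sym (ℤP.+-identityʳ _)
coeff-+ₚ (a ∷ p) []      (suc m) = sym (ℤP.+-identityʳ _)
coeff-+ₚ (a ∷ p) (b ∷ q) zero    = refl
coeff-+ₚ (a ∷ p) (b ∷ q) (suc m) = coeff-+ₚ p q m

coeff-· : ∀ c p m → coeff (c · p) m ≡ c * coeff p m
coeff-· c []      m       = sym (ℤP.*-zeroʳ c)
coeff-· c (a ∷ p) zero    = refl
coeff-· c (a ∷ p) (suc m) = coeff-· c p m

Lead-+ₚʳ : ∀ p q d t → Lead p d t → VanishesFrom q d → Lead (p +ₚ q) d t
Lead-+ₚʳ p q d t (pd , pz) qz =
    trans (coeff-+ₚ p q d) (trans (cong₂ _+_ pd (qz d ℕP.≤-refl)) (ℤP.+-identityʳ t))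
  , λ m d<m → trans (coeff-+ₚ p q m)
                (trans (cong₂ _+_ (pz m d<m) (qz m (ℕP.<⇒≤ d<m))) (ℤP.+-identityʳ 0ℤ))

Lead-+ₚˡ : ∀ p q d t → VanishesFrom p d → Lead q d t → Lead (p +ₚ q) d t
Lead-+ₚˡ p q d t pz (qd , qz) =
    trans (coeff-+ₚ p q d) (trans (cong₂ _+_ (pz d ℕP.≤-refl) qd) (ℤP.+-identityˡ t))
  , λ m d<m → trans (coeff-+ₚ p q m)
                (trans (cong₂ _+_ (pz m (ℕP.<⇒≤ d<m)) (qz m d<m)) (ℤP.+-identityʳ 0ℤ))

Lead-· : ∀ a q e t → Lead q e t → Lead (a · q) e (a * t)
Lead-· a q e t (qe , qz) =
    trans (coeff-· a q e) (cong (a *_) qe)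
  , λ m e<m → trans (coeff-· a q m) (trans (cong (a *_) (qz m e<m)) (ℤP.*-zeroʳ a))

Lead-shift : ∀ p d t → Lead p d t → Lead (0ℤ ∷ p) (suc d) t
Lead-shift p d t (pd , pz) = pd , λ { (suc m) (s≤s d<m) → pz m d<m }

VanishesFrom-zero : ∀ p d → VanishesFrom p 0 → VanishesFrom (0ℤ ∷ p) d
VanishesFrom-zero p d pz zero    _ = refl
VanishesFrom-zero p d pz (suc m) _ = pz m z≤n

VanishesFrom-mono : ∀ p {d e} → d ≤ e → VanishesFrom p d → VanishesFrom p e
VanishesFrom-mono p d≤e pz m e≤m = pz m (ℕP.≤-trans d≤e e≤m)

*ₚ-zero : ∀ p q → VanishesFrom p 0 → VanishesFrom (p *ₚ q) 0
*ₚ-zero []      q pz m _ = refl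
*ₚ-zero (a ∷ p) q pz m _ =
  trans (coeff-+ₚ (a · q) (0ℤ ∷ (p *ₚ q)) m)
        (cong₂ _+_ scaled-by-zero
          (VanishesFrom-zero (p *ₚ q) 0 (*ₚ-zero p q (λ m _ → pz (suc m) z≤n)) m z≤n))
  where
  scaled-by-zero : coeff (a · q) m ≡ 0ℤ
  scaled-by-zero =
    trans (coeff-· a q m) (trans (cong (_* coeff q m) (pz 0 z≤n)) (ℤP.*-zeroˡ (coeff q m)))

Lead-*ₚ : ∀ p q d e s t → Lead p d s → Lead q e t → Lead (p *ₚ q) (d ℕ.+ e) (s * t)
Lead-*ₚ []      q d       e s t (refl , _)  _  = sym (ℤP.*-zeroˡ t) , λ m _ → refl
Lead-*ₚ (a ∷ p) q zero    e s t (refl , pz) lq =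
  Lead-+ₚʳ (a · q) (0ℤ ∷ (p *ₚ q)) e (a * t) (Lead-· a q e t lq)
    (VanishesFrom-zero (p *ₚ q) e (*ₚ-zero p q (λ m _ → pz (suc m) (s≤s z≤n))))
Lead-*ₚ (a ∷ p) q (suc d) e s t (pd , pz) lq =
  Lead-+ₚˡ (a · q) (0ℤ ∷ (p *ₚ q)) (suc (d ℕ.+ e)) (s * t)
    (VanishesFrom-mono (a · q) (s≤s (ℕP.m≤n+m e d)) (Lead-· a q e t lq .proj₂))
    (Lead-shift (p *ₚ q) (d ℕ.+ e) (s * t)
      (Lead-*ₚ p q d e s t (pd , λ m d<m → pz (suc m) (s≤s d<m)) lq))

Lead-linP : ∀ a b → Lead (linP (a , b)) 1 a
Lead-linP a b = refl , λ { (suc zero) (s≤s ()) ; (suc (suc m)) _ → refl }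

Lead-prodP : ∀ fs → Lead (prodP (map linP fs)) (length fs) (∏ proj₁ fs)
Lead-prodP []             = refl , λ { (suc m) _ → refl }
Lead-prodP ((a , b) ∷ fs) =
  Lead-*ₚ (linP (a , b)) (prodP (map linP fs)) 1 (length fs) a (∏ proj₁ fs)
    (Lead-linP a b) (Lead-prodP fs)

Lead-iterP : ∀ k c → Lead (iterP k c) (2 ^ k) 1ℤ
Lead-iterP zero    c = refl , λ { (suc zero) (s≤s ()) ; (suc (suc m)) _ → refl }
Lead-iterP (suc k) c =
  subst (λ d → Lead (iterP (suc k) c) d 1ℤ) doubling
    (Lead-+ₚʳ (iterP k c *ₚ iterP k c) (constP (- c k)) (2 ^ k ℕ.+ 2 ^ k) 1ℤ
      (Lead-*ₚ (iterP k c) (iterP k c) (2 ^ k) (2 ^ k) 1ℤ 1ℤ (Lead-iterP k c) (Lead-iterP k c))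
      constant-vanishes)
  where
  doubling : 2 ^ k ℕ.+ 2 ^ k ≡ 2 ^ suc k
  doubling = cong (2 ^ k ℕ.+_) (sym (ℕP.+-identityʳ (2 ^ k)))
  positive : 1 ≤ 2 ^ k ℕ.+ 2 ^ k
  positive = ℕP.≤-trans (ℕP.m^n>0 2 k) (ℕP.m≤m+n (2 ^ k) (2 ^ k))
  constant-vanishes : VanishesFrom (constP (- c k)) (2 ^ k ℕ.+ 2 ^ k)
  constant-vanishes m d≤m with ℕP.≤-trans positive d≤m
  ... | s≤s _ = refl

Lead-≈ₚ : ∀ p q d t → p ≈ₚ q → Lead p d t → Lead q d t
Lead-≈ₚ p q d t p≈q (pd , pz) = trans (sym (p≈q d)) pd , λ m d<m → trans (sym (p≈q m)) (pz m d<m)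

Lead-unique : ∀ p d e s t → Lead p d s → Lead p e t → ¬ s ≡ 0ℤ → ¬ t ≡ 0ℤ → d ≡ e × s ≡ t
Lead-unique p d e s t (pd , pz) (pe , pz′) s≢0 t≢0 with ℕP.<-cmp d e
... | tri< d<e _ _ = ⊥-elim (t≢0 (trans (sym pe) (pz e d<e)))
... | tri≈ _ refl _ = refl , trans (sym pd) pe
... | tri> _ _ e<d = ⊥-elim (s≢0 (trans (sym pd) (pz′ d e<d)))

∏-unit : ∀ (fs : List (ℤ × ℤ)) → ∣ ∏ proj₁ fs ∣ ≡ 1 → All (λ ab → ∣ proj₁ ab ∣ ≡ 1) fs
∏-unit []             _ = []
∏-unit ((a , b) ∷ fs) e =
  ℕP.m*n≡1⇒m≡1 ∣ a ∣ ∣ ∏ proj₁ fs ∣ e′ ∷ ∏-unit fs (ℕP.m*n≡1⇒n≡1 ∣ a ∣ ∣ ∏ proj₁ fs ∣ e′)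
  where
  e′ : ∣ a ∣ ℕ.* ∣ ∏ proj₁ fs ∣ ≡ 1
  e′ = trans (sym (ℤP.abs-* a (∏ proj₁ fs))) e

record UnitFactorisation (k : ℕ) (c : ℕ → ℤ) : Set where
  constructor unitFactors
  field
    factors : List (ℤ × ℤ)
    count   : length factors ≡ 2 ^ k
    units   : All (λ ab → ∣ proj₁ ab ∣ ≡ 1) factors
    values  : ∀ n → iterate k c n ≡ ∏ (λ ab → lin ab n) factors

-- Compare the leading term 1·x^(2^k) with that of the product of the factors.
unitFactorisation : ∀ k c → Crumbles (iterP k c) → UnitFactorisation k c
unitFactorisation k c (fs , nonzero , P≈∏) = record
  { factors = fs
  ; count   = proj₁ same-lead
  ; units   = ∏-unit fs (cong ∣_∣ (proj₂ same-lead))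
  ; values  = λ n → begin
      iterate k c n                     ≡⟨ sym (eval-iterP k c n) ⟩
      eval (iterP k c) n                ≡⟨ eval-≈ₚ (iterP k c) (prodP (map linP fs)) n P≈∏ ⟩
      eval (prodP (map linP fs)) n      ≡⟨ eval-prodP fs n ⟩
      ∏ (λ ab → lin ab n) fs            ∎
  }
  where
  ∏≢0 : ¬ ∏ proj₁ fs ≡ 0ℤ
  ∏≢0 e = All¬⇒¬Any nonzero (∏-zero proj₁ fs e)
  same-lead : length fs ≡ 2 ^ k × ∏ proj₁ fs ≡ 1ℤ
  same-lead = Product.map sym sym
    (Lead-unique (prodP (map linP fs)) (2 ^ k) (length fs) 1ℤ (∏ proj₁ fs)
      (Lead-≈ₚ (iterP k c) (prodP (map linP fs)) (2 ^ k) 1ℤ P≈∏ (Lead-iterP k c)) (Lead-prodP fs)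
      (λ ()) ∏≢0)

unit-square : ∀ a → ∣ a ∣ ≡ 1 → a * a ≡ 1ℤ
unit-square (+ 1)    _ = refl
unit-square (+ suc (suc n)) ()
unit-square (+ 0) ()
unit-square -[1+ 0 ] _ = refl
unit-square -[1+ suc n ] ()

root : ℤ × ℤ → ℤ
root (a , b) = - (a * b)

lin-root : ∀ a b → ∣ a ∣ ≡ 1 → lin (a , b) (root (a , b)) ≡ 0ℤ
lin-root a b u =
  trans (expand a b) (trans (cong (λ s → (1ℤ - s) * b) (unit-square a u)) (ℤP.*-zeroˡ b))
  where
  expand : ∀ a b → a * - (a * b) + b ≡ (1ℤ - a * a) * b
  expand = solve-∀

-- Since a² = 1, n − root = a (an + b): the factor divides n − root.
lin-divides : ∀ a b n → ∣ a ∣ ≡ 1 → lin (a , b) n Signed.∣ n - root (a , b)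
lin-divides a b n u = divides a (trans (expand a b n)
  (trans (cong (λ s → (1ℤ - s) * n + a * (a * n + b)) (unit-square a u)) (cancel n (a * (a * n + b)))))
  where
  expand : ∀ a b n → n - - (a * b) ≡ (1ℤ - a * a) * n + a * (a * n + b)
  expand = solve-∀
  cancel : ∀ n x → (1ℤ - 1ℤ) * n + x ≡ x
  cancel = solve-∀

-- The iteration has an integer root: that of the first factor.
iterate-root : ∀ k c → UnitFactorisation k c → ∃ λ r → iterate k c r ≡ 0ℤ
iterate-root k c (unitFactors []             len _       _)      =
  ⊥-elim (ℕP.<⇒≢ (ℕP.m^n>0 2 k) len)
iterate-root k c (unitFactors ((a , b) ∷ fs) _   (u ∷ _) values) =
  root (a , b) , trans (values (root (a , b)))
                   (trans (cong (_* ∏ (λ ab → lin ab (root (a , b))) fs) (lin-root a b u))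
                          (ℤP.*-zeroˡ (∏ (λ ab → lin ab (root (a , b))) fs)))

step-difference : ∀ x y c → (x * x + - c) - (y * y + - c) ≡ (x - y) * (x + y)
step-difference = solve-∀

iterate-difference : ∀ c j n r → (n - r) Signed.∣ iterate j c n - iterate j c r
iterate-difference c zero    n r = ∣-refl
iterate-difference c (suc j) n r rewrite step-difference (iterate j c n) (iterate j c r) (c j) =
  ∣m⇒∣m*n _ (iterate-difference c j n r)

iterate-sum-divides : ∀ c j m n r → j < m →
  (iterate j c n + iterate j c r) Signed.∣ iterate m c n - iterate m c r
iterate-sum-divides c j m n r j<m = go m (ℕP.≤⇒≤′ j<m)
  where
  go : ∀ m → suc j ≤′ m → (iterate j c n + iterate j c r) Signed.∣ iterate m c n - iterate m c r
  go .(suc j) ≤′-refl rewrite step-difference (iterate j c n) (iterate j c r) (c j) =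
    ∣n⇒∣m*n (iterate j c n - iterate j c r) ∣-refl
  go (suc m) (≤′-step j<m) rewrite step-difference (iterate m c n) (iterate m c r) (c m) =
    ∣m⇒∣m*n _ (go m j<m)

Unbounded : (ℤ → ℤ) → Set
Unbounded h = ∀ B → ∃ λ n → B < ∣ h n ∣

unbounded-shift : ∀ h d → Unbounded h → Unbounded (λ n → h n + d)
unbounded-shift h d unbounded B with unbounded (B ℕ.+ ∣ d ∣)
... | n , big = n , ℕP.+-cancelʳ-< ∣ d ∣ B (∣ h n + d ∣) (ℕP.<-≤-trans big triangle)
  where
  cancel : ∀ x d → x + d - d ≡ x
  cancel = solve-∀
  triangle : ∣ h n ∣ ≤ ∣ h n + d ∣ ℕ.+ ∣ d ∣
  triangle = subst (λ x → ∣ x ∣ ≤ ∣ h n + d ∣ ℕ.+ ∣ d ∣) (cancel (h n) d)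
                   (ℤP.∣i-j∣≤∣i∣+∣j∣ (h n + d) d)

unbounded-square : ∀ h → Unbounded h → Unbounded (λ n → h n * h n)
unbounded-square h unbounded B with unbounded B
... | n , big = n , ℕP.<-≤-trans big (subst (∣ h n ∣ ≤_) (sym (ℤP.abs-* (h n) (h n))) grows)
  where
  instance
    nonzero : ℕ.NonZero ∣ h n ∣
    nonzero = ℕ.>-nonZero (ℕP.≤-<-trans z≤n big)
  grows : ∣ h n ∣ ≤ ∣ h n ∣ ℕ.* ∣ h n ∣
  grows = ℕP.m≤m*n ∣ h n ∣ ∣ h n ∣

iterate-unbounded : ∀ c j → Unbounded (iterate j c)
iterate-unbounded c zero    B = + suc B , ℕP.≤-refl
iterate-unbounded c (suc j) =
  unbounded-shift (λ n → iterate j c n * iterate j c n) (- c j)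
    (unbounded-square (iterate j c) (iterate-unbounded c j))

divisor-too-large : ∀ {m n} → m ℕD.∣ n → n < m → n ≡ 0
divisor-too-large {n = zero}  _   _   = refl
divisor-too-large {n = suc n} m∣n n<m = ⊥-elim (ℕP.<⇒≱ n<m (ℕD.∣⇒≤ m∣n))

unbounded-divisors : ∀ h W → Unbounded h → (∀ n → h n Signed.∣ W) → W ≡ 0ℤ
unbounded-divisors h W unbounded divides-W with unbounded ∣ W ∣
... | n , big = ℤP.∣i∣≡0⇒i≡0 (divisor-too-large (∣⇒∣ᵤ (divides-W n)) big)

-- With g(n) = f_j(n) + f_j(r) and wᵢ = g(rᵢ), every g(n)
-- divides f_k(n) = ∏ (aᵢn + bᵢ), which divides ∏ (g(n) − wᵢ) ≡ ∏ (−wᵢ) mod g(n);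
-- as g is unbounded, ∏ (−wᵢ) = 0, so some wᵢ vanishes.
partner-root : ∀ k c → UnitFactorisation k c → ∀ r → iterate k c r ≡ 0ℤ →
  ∀ j → j < k → ∃ λ r′ → iterate j c r′ ≡ - iterate j c r
partner-root k c (unitFactors fs _ units values) r root-r j j<k =
  partner (Any.satisfied (∏-zero (λ ab → - w ab) fs W≡0))
  where
  d : ℤ
  d = iterate j c r
  g : ℤ → ℤ
  g n = iterate j c n + d
  w : ℤ × ℤ → ℤ
  w ab = g (root ab)
  W : ℤ
  W = ∏ (λ ab → - w ab) fs

  recover : ∀ x d → x ≡ - d - - (x + d)
  recover = solve-∀
  shifted-difference : ∀ x y d → (x + d) - (y + d) ≡ x - y
  shifted-difference = solve-∀
  reduce-mod : ∀ x w → (x - w) - - w ≡ x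
  reduce-mod = solve-∀
  complement : ∀ a b → a - (a - b) ≡ b
  complement = solve-∀

  g∣f_k : ∀ n → g n Signed.∣ iterate k c n
  g∣f_k n = subst (g n Signed.∣_)
    (trans (cong (_-_ (iterate k c n)) root-r) (ℤP.+-identityʳ (iterate k c n)))
    (iterate-sum-divides c j k n r j<k)

  factor∣ : ∀ n ab → ∣ proj₁ ab ∣ ≡ 1 → lin ab n Signed.∣ g n - w ab
  factor∣ n (a , b) u = ∣-trans (lin-divides a b n u)
    (subst ((n - root (a , b)) Signed.∣_)
      (sym (shifted-difference (iterate j c n) (iterate j c (root (a , b))) d))
      (iterate-difference c j n (root (a , b))))

  g∣W : ∀ n → g n Signed.∣ W
  g∣W n = subst (g n Signed.∣_) (complement (∏ (λ ab → g n - w ab) fs) W)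
    (∣m∣n⇒∣m-n g∣∏ (∏-cong-mod (g n) (λ ab → g n - w ab) (λ ab → - w ab) fs
                      (λ ab → subst (g n Signed.∣_) (sym (reduce-mod (g n) (w ab))) ∣-refl)))
    where
    g∣∏ : g n Signed.∣ ∏ (λ ab → g n - w ab) fs
    g∣∏ = ∣-trans (subst (g n Signed.∣_) (values n) (g∣f_k n))
                   (∏-mono-∣ (λ ab → lin ab n) (λ ab → g n - w ab) fs
                     (All.map (λ {ab} → factor∣ n ab) units))

  W≡0 : W ≡ 0ℤ
  W≡0 = unbounded-divisors g W (unbounded-shift (iterate j c) d (iterate-unbounded c j)) g∣W

  partner : (∃ λ ab → - w ab ≡ 0ℤ) → ∃ λ r′ → iterate j c r′ ≡ - d
  partner (ab , −w≡0) = root ab , (begin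
    iterate j c (root ab)            ≡⟨ recover (iterate j c (root ab)) d ⟩
    - d - - w ab                     ≡⟨ cong (λ z → - d - z) −w≡0 ⟩
    - d - 0ℤ                         ≡⟨ ℤP.+-identityʳ (- d) ⟩
    - d                              ∎)

two-is-prime : Prime 2
two-is-prime = from-yes (prime? 2)

two∣product : ∀ p q → + 2 Signed.∣ p * q → + 2 Signed.∣ p ⊎ + 2 Signed.∣ q
two∣product p q 2∣pq = Sum.map ∣ᵤ⇒∣ ∣ᵤ⇒∣
  (euclidsLemma ∣ p ∣ ∣ q ∣ two-is-prime (subst (2 ℕD.∣_) (ℤP.abs-* p q) (∣⇒∣ᵤ 2∣pq)))

-- A difference of two squares is odd or divisible by 4, because a − b and
-- a + b have the same parity.  Hence a² − b² = 2d forces d to be even.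
square-difference : ∀ a b d → a * a - b * b ≡ + 2 * d → + 2 Signed.∣ d
square-difference a b d e =
  *-cancelˡ-∣ (+ 2) (subst (+ 2 * + 2 Signed.∣_) (trans (factor a b) e)
    (∣-trans (*-monoˡ-∣ (+ 2) (proj₁ both-even)) (*-monoʳ-∣ (a - b) (proj₂ both-even))))
  where
  factor : ∀ a b → (a - b) * (a + b) ≡ a * a - b * b
  factor = solve-∀
  same-parity : ∀ a b → a + b ≡ (a - b) + b * + 2
  same-parity = solve-∀
  2∣2b : + 2 Signed.∣ b * + 2
  2∣2b = ∣n⇒∣m*n b ∣-refl
  both-even : + 2 Signed.∣ a - b × + 2 Signed.∣ a + b
  both-even with two∣product (a - b) (a + b)
                   (divides d (trans (trans (factor a b) e) (ℤP.*-comm (+ 2) d)))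
  ... | inj₁ 2∣a-b = 2∣a-b , subst (+ 2 Signed.∣_) (sym (same-parity a b)) (∣m∣n⇒∣m+n 2∣a-b 2∣2b)
  ... | inj₂ 2∣a+b = ∣m+n∣n⇒∣m (subst (+ 2 Signed.∣_) (same-parity a b) 2∣a+b) 2∣2b , 2∣a+b

-- Given partner roots below level k, every f_j(r) with 1 ≤ j ≤ k is even:
-- 2 f_j(r) = f_j(r) − f_j(r′) = f_{j−1}(r)² − f_{j−1}(r′)².
even-along-root : ∀ k c r → iterate k c r ≡ 0ℤ →
  (∀ j → j < k → ∃ λ r′ → iterate j c r′ ≡ - iterate j c r) →
  ∀ j → 1 ≤ j → j ≤ k → + 2 Signed.∣ iterate j c r
even-along-root k c r root-r partners (suc j) _ j+1≤k with ℕP.m≤n⇒m<n∨m≡n j+1≤k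
... | inj₂ refl = divides 0ℤ root-r
... | inj₁ j+1<k with partners (suc j) j+1<k
...   | r′ , opposite =
  square-difference (iterate j c r) (iterate j c r′) (iterate (suc j) c r) (begin
    x * x - y * y                                  ≡⟨ same-shift x y (c j) ⟩
    iterate (suc j) c r - iterate (suc j) c r′     ≡⟨ cong (_-_ (iterate (suc j) c r)) opposite ⟩
    iterate (suc j) c r - - iterate (suc j) c r    ≡⟨ twice (iterate (suc j) c r) ⟩
    + 2 * iterate (suc j) c r                      ∎)
  where
  x y : ℤ
  x = iterate j c r
  y = iterate j c r′
  same-shift : ∀ x y c → x * x - y * y ≡ (x * x + - c) - (y * y + - c)
  same-shift = solve-∀
  twice : ∀ z → z - - z ≡ + 2 * z
  twice = solve-∀

constant-even : ∀ c i r → + 2 Signed.∣ iterate i c r → + 2 Signed.∣ iterate (suc i) c r →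
  + 2 Signed.∣ c i
constant-even c i r even-i even-i+1 =
  subst (+ 2 Signed.∣_) (sym (c-as-difference (iterate i c r) (c i)))
    (∣m∣n⇒∣m-n (∣m⇒∣m*n (iterate i c r) even-i) even-i+1)
  where
  c-as-difference : ∀ x c → c ≡ x * x - (x * x + - c)
  c-as-difference = solve-∀

lemma3 : (k : ℕ) → 1 ≤ k → (c : ℕ → ℤ) →
    Crumbles (iterP k c) →
    ∀ (i : ℕ) → 1 ≤ i → i < k → (+ 2) ∣ c i
-- Take the root r of a unit factor; its partner roots make f_i(r) and f_{i+1}(r)
-- even, hence so is c_i.  (Signed divisibility is used throughout and converted
-- to the unsigned divisibility of the statement at the end.)
lemma3 k _ c crumbles i 1≤i i<k =
  ∣⇒∣ᵤ (constant-even c i r (even i 1≤i (ℕP.<⇒≤ i<k)) (even (suc i) (s≤s z≤n) i<k))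
  where
  factorisation : UnitFactorisation k c
  factorisation = unitFactorisation k c crumbles
  r : ℤ
  r = proj₁ (iterate-root k c factorisation)
  root-r : iterate k c r ≡ 0ℤ
  root-r = proj₂ (iterate-root k c factorisation)
  even : ∀ j → 1 ≤ j → j ≤ k → + 2 Signed.∣ iterate j c r
  even = even-along-root k c r root-r (partner-root k c factorisation r root-r)
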